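{- Let $\mathbf G=(\{0,1\},\downarrow)$, where $\downarrow$ is negated disjunction (NOR): $x\downarrow y=1$ if and only if $x=y=0$. Then $s^{\mathrm{ac}}_n(\mathbf G)=D_{n-1}$ for all $n\ge1$.
   Context: For $X_n=\{x_1,\dots,x_n\}$, groupoid terms are built recursively from variables by $(s,t)\mapsto(st)$; a full linear term over $X_n$ is a term in which each variable occurs exactly once. $s^{\mathrm{ac}}_n(\mathbf G)$ is the number of distinct $n$-ary term operations on $\mathbf G$ induced by full linear terms over $X_n$. $D_m=(2m)!/(2^mm!)$. -}

module Defs where

open import Data.Nat using (ℕ; zero; suc; _+_; _*_; _^_; _!; NonZero)
open import Data.Nat.Properties using (m^n≢0; m*n≢0; _!≢0)
open import Data.Nat.DivMod using (_/_)
open import Data.Fin using (Fin; _≟_)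
open import Data.Bool using (Bool; true; false)
open import Relation.Nullary using (yes; no)

data Term (n : ℕ) : Set where
  var : Fin n → Term n
  _·_ : Term n → Term n → Term n

occ : ∀ {n} → Fin n → Term n → ℕ
occ i (var j) with i ≟ j
... | yes _ = 1
... | no  _ = 0
occ i (s · t) = occ i s + occ i t

FullLinear : ∀ {n} → Term n → Set
FullLinear {n} t = (i : Fin n) → occ i t ≡ 1
  where open import Relation.Binary.PropositionalEquality using (_≡_)

_↓_ : Bool → Bool → Bool
false ↓ false = true
_     ↓ _     = false

⟦_⟧ : ∀ {n} → Term n → (Fin n → Bool) → Bool
⟦ var i ⟧ a = a i
⟦ s · t ⟧ a = ⟦ s ⟧ a ↓ ⟦ t ⟧ a

D : ℕ → ℕ
D m = ((2 * m) !) / (2 ^ m * m !)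
  where instance
          nz : NonZero (2 ^ m * m !)
          nz = m*n≢0 (2 ^ m) (m !) {{m^n≢0 2 m}} {{m !≢0}}

{-# OPTIONS --safe #-}

-- Terms that differ only by commuting the arguments of products induce the same operation,
-- since ↓ is commutative. Conversely, linear terms s = a · b and t = c · d with the same
-- variables and the same operation agree up to commutativity: fixing the variables of b at a
-- point where b is false turns s into ¬a, so ¬a = ¬c ∧ ¬d as functions of the remaining
-- variables. If a shared variables with both c and d, then a = a₁ · a₂ and ¬a = a₁ ∨ a₂ would
-- be a disjunction of satisfiable functions of disjoint sets of variables that equals a
-- conjunction of falsifiable ones, which is impossible. Hence, after possibly swapping c and d,
-- a, c and b, d have the same variables and operations, and induction applies.
-- So s^ac_n(G) counts full linear terms up to commutativity. These arise without repetition by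
-- inserting a new variable as the sibling of one of the 2k − 1 subterms of a term on k
-- variables, so there are 1 · 3 · … · (2n − 3) = D_{n−1} of them.
module Submission where

open import Defs
open import Data.Nat
  using (ℕ; zero; suc; _+_; _*_; _^_; _!; _≤_; _<_; _<ᵇ_; z≤n; s≤s; NonZero)
open import Data.Nat.Properties
  using ( +-comm; +-assoc; +-suc; +-identityʳ; *-suc; ≤-trans; ≤-reflexive; +-mono-≤; 1+n≰n; 1+n≢0
        ; m+n≤o⇒m≤o; m+n≤o⇒n≤o; m+n≡0⇒m≡0; m+n≡0⇒n≡0; m≢1+m+n; m≢1+n+m; <ᵇ⇒<; <⇒<ᵇ
        ; m^n≢0; m*n≢0; _!≢0; +-commutativeSemigroup )
open import Data.Fin using (Fin; zero; suc; _≟_)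
open import Data.Fin.Properties using (suc-injective)
open import Data.Bool using (Bool; true; false; not; _∧_; _∨_; if_then_else_; T)
open import Data.Bool.Properties
  using ( T-≡; T-∨; ∧-comm; ∨-comm; ∨-zeroʳ; ∧-zeroʳ; ∨-conicalˡ; ∨-conicalʳ; ∧-conicalˡ; ∧-conicalʳ
        ; not-injective )
open import Data.Vec.Functional using (updateAt)
open import Data.Vec.Functional.Properties using (updateAt-updates; updateAt-minimal)
open import Data.Maybe using (Maybe; just; nothing; maybe′)
open import Data.Maybe.Relation.Binary.Pointwise as Pointwise using (Pointwise; just; nothing)
open import Data.List using (List; []; _∷_; _++_; map; length; concatMap)
open import Data.List.Properties using (length-++; length-map)
open import Data.List.Relation.Unary.All using (All; []; _∷_)
import Data.List.Relation.Unary.All as All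
import Data.List.Relation.Unary.All.Properties as All
open import Data.List.Relation.Unary.Any using (Any; here; there)
import Data.List.Relation.Unary.Any as Any
import Data.List.Relation.Unary.Any.Properties as Any
open import Data.List.Relation.Unary.AllPairs using (AllPairs; []; _∷_)
import Data.List.Relation.Unary.AllPairs as AllPairs
import Data.List.Relation.Unary.AllPairs.Properties as AllPairs
open import Data.Nat.DivMod using (_/_; m*n/n≡m)
open import Data.Nat.Tactic.RingSolver using (solve-∀)
open import Algebra.Properties.CommutativeSemigroup +-commutativeSemigroup using (xy∙z≈xz∙y)
open import Data.Empty using (⊥; ⊥-elim)
open import Data.Product using (Σ; ∃; _×_; _,_; proj₁; proj₂; map₂)
open import Data.Sum using (_⊎_; inj₁; inj₂)
open import Function using (_∘_)
open import Function.Definitions using (Injective)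
open import Function.Bundles using (Equivalence)
open import Relation.Binary.PropositionalEquality
open import Relation.Nullary using (¬_; yes; no)

private
  variable
    n : ℕ
    i j v : Fin n
    a b c d s t : Term n

↓-comm : ∀ x y → x ↓ y ≡ y ↓ x
↓-comm false false = refl
↓-comm false true  = refl
↓-comm true  false = refl
↓-comm true  true  = refl

↓-falseʳ : ∀ x → x ↓ false ≡ not x
↓-falseʳ false = refl
↓-falseʳ true  = refl

↓≡not∧not : ∀ x y → x ↓ y ≡ not x ∧ not y
↓≡not∧not false false = refl
↓≡not∧not false true  = refl
↓≡not∧not true  y     = refl

not-↓ : ∀ x y → not (x ↓ y) ≡ x ∨ y
not-↓ false false = refl
not-↓ false true  = refl
not-↓ true  y     = refl

↓≡true⁻ : ∀ x y → x ↓ y ≡ true → x ≡ false × y ≡ false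
↓≡true⁻ false false _ = refl , refl

T-ext : ∀ {x y} → (T x → T y) → (T y → T x) → x ≡ y
T-ext {false} {false} _ _ = refl
T-ext {false} {true}  _ f = ⊥-elim (f _)
T-ext {true}  {false} f _ = ⊥-elim (f _)
T-ext {true}  {true}  _ _ = refl

m+n≡1 : ∀ m n → m + n ≡ 1 → (m ≡ 1 × n ≡ 0) ⊎ (m ≡ 0 × n ≡ 1)
m+n≡1 zero          n       e  = inj₂ (refl , e)
m+n≡1 (suc zero)    zero    _  = inj₁ (refl , refl)
m+n≡1 (suc zero)    (suc n) ()
m+n≡1 (suc (suc m)) n       ()

-- Variables and linearity

occ-var-self : (i : Fin n) → occ i (var i) ≡ 1
occ-var-self i with i ≟ i
... | yes _  = refl
... | no i≢i = ⊥-elim (i≢i refl)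

occ-var-≢ : i ≢ j → occ i (var j) ≡ 0
occ-var-≢ {i = i} {j = j} i≢j with i ≟ j
... | yes i≡j = ⊥-elim (i≢j i≡j)
... | no _    = refl

-- Opaque, so that the term t can be inferred from a proof of T (vars t i).
opaque
  vars : Term n → Fin n → Bool
  vars t i = 0 <ᵇ occ i t

opaque
  unfolding vars

  vars-var-self : (i : Fin n) → T (vars (var i) i)
  vars-var-self i rewrite occ-var-self i = _

  vars-var⁻ : T (vars (var j) i) → i ≡ j
  vars-var⁻ {j = j} {i = i} i∈j with i ≟ j
  ... | yes i≡j = i≡j

  vars⇒occ>0 : T (vars t i) → 0 < occ i t
  vars⇒occ>0 {t = t} {i = i} = <ᵇ⇒< 0 (occ i t)

  occ>0⇒vars : 0 < occ i t → T (vars t i)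
  occ>0⇒vars = <⇒<ᵇ

  vars-· : ∀ (a b : Term n) i → vars (a · b) i ≡ vars a i ∨ vars b i
  vars-· a b i with occ i a
  ... | zero  = refl
  ... | suc _ = refl

vars-·ˡ : T (vars a i) → T (vars (a · b) i)
vars-·ˡ {a = a} {i = i} {b = b} i∈a =
  subst T (sym (vars-· a b i)) (Equivalence.from T-∨ (inj₁ i∈a))

vars-·ʳ : T (vars b i) → T (vars (a · b) i)
vars-·ʳ {b = b} {i = i} {a = a} i∈b =
  subst T (sym (vars-· a b i)) (Equivalence.from T-∨ (inj₂ i∈b))

vars-·⁻ : T (vars (a · b) i) → T (vars a i) ⊎ T (vars b i)
vars-·⁻ {a = a} {b = b} {i = i} i∈ab = Equivalence.to T-∨ (subst T (vars-· a b i) i∈ab)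

vars-nonempty : (t : Term n) → ∃ λ i → T (vars t i)
vars-nonempty (var i) = i , vars-var-self i
vars-nonempty (a · b) with vars-nonempty a
... | i , i∈a = i , vars-·ˡ i∈a

Disjoint : Term n → Term n → Set
Disjoint a b = ∀ i → T (vars a i) → T (vars b i) → ⊥

disjoint-sym : Disjoint a b → Disjoint b a
disjoint-sym a∩b i i∈b i∈a = a∩b i i∈a i∈b

data Linear {n : ℕ} : Term n → Set where
  var  : Linear (var i)
  prod : Linear a → Linear b → Disjoint a b → Linear (a · b)

linear-swap : Linear (a · b) → Linear (b · a)
linear-swap (prod la lb a∩b) = prod lb la (disjoint-sym a∩b)

occ≤1⇒linear : (t : Term n) → (∀ i → occ i t ≤ 1) → Linear t
occ≤1⇒linear (var i) _ = var
occ≤1⇒linear (a · b) occ≤1 =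
  prod (occ≤1⇒linear a (λ i → m+n≤o⇒m≤o (occ i a) (occ≤1 i)))
       (occ≤1⇒linear b (λ i → m+n≤o⇒n≤o (occ i a) (occ≤1 i)))
       disjoint
  where
  disjoint : Disjoint a b
  disjoint i i∈a i∈b =
    1+n≰n (≤-trans (+-mono-≤ (vars⇒occ>0 i∈a) (vars⇒occ>0 i∈b)) (occ≤1 i))

fullLinear⇒linear : FullLinear t → Linear t
fullLinear⇒linear {t = t} fl = occ≤1⇒linear t (λ i → ≤-reflexive (fl i))

fullLinear⇒vars : FullLinear t → ∀ i → vars t i ≡ true
fullLinear⇒vars fl i = Equivalence.to T-≡ (occ>0⇒vars (subst (0 <_) (sym (fl i)) (s≤s z≤n)))

nodes : Term n → ℕ
nodes (var _) = 0
nodes (a · b) = suc (nodes a + nodes b)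

-- Equality up to commutativity

data _~_ {n : ℕ} : Term n → Term n → Set where
  var~ : i ≡ j → var i ~ var j
  str  : a ~ c → b ~ d → (a · b) ~ (c · d)
  crs  : a ~ d → b ~ c → (a · b) ~ (c · d)

~-refl : (t : Term n) → t ~ t
~-refl (var i) = var~ refl
~-refl (a · b) = str (~-refl a) (~-refl b)

~-swap : (a b : Term n) → (a · b) ~ (b · a)
~-swap a b = crs (~-refl a) (~-refl b)

~-trans : a ~ b → b ~ c → a ~ c
~-trans (var~ e) (var~ e′)  = var~ (trans e e′)
~-trans (str p q) (str r s) = str (~-trans p r) (~-trans q s)
~-trans (str p q) (crs r s) = crs (~-trans p r) (~-trans q s)
~-trans (crs p q) (str r s) = crs (~-trans p s) (~-trans q r)
~-trans (crs p q) (crs r s) = str (~-trans p s) (~-trans q r)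

~-sound : s ~ t → ⟦ s ⟧ ≗ ⟦ t ⟧
~-sound (var~ refl) x = refl
~-sound (str p q)   x = cong₂ _↓_ (~-sound p x) (~-sound q x)
~-sound (crs {d = d} {c = c} p q) x =
  trans (cong₂ _↓_ (~-sound p x) (~-sound q x)) (↓-comm (⟦ d ⟧ x) (⟦ c ⟧ x))

~-occ : s ~ t → ∀ i → occ i s ≡ occ i t
~-occ (var~ refl) i = refl
~-occ (str p q)   i = cong₂ _+_ (~-occ p i) (~-occ q i)
~-occ (crs {d = d} {c = c} p q) i =
  trans (cong₂ _+_ (~-occ p i) (~-occ q i)) (+-comm (occ i d) (occ i c))

~-nodes : s ~ t → nodes s ≡ nodes t
~-nodes (var~ refl) = refl
~-nodes (str p q)   = cong suc (cong₂ _+_ (~-nodes p) (~-nodes q))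
~-nodes (crs {d = d} {c = c} p q) =
  cong suc (trans (cong₂ _+_ (~-nodes p) (~-nodes q)) (+-comm (nodes d) (nodes c)))

opaque
  unfolding vars

  ~-vars : s ~ t → vars s ≗ vars t
  ~-vars p i = cong (0 <ᵇ_) (~-occ p i)

·≁ˡ : ¬ (a · b) ~ a
·≁ˡ {a = a} p = m≢1+m+n (nodes a) (sym (~-nodes p))

·≁ʳ : ¬ (a · b) ~ b
·≁ʳ {b = b} p = m≢1+n+m (nodes b) (sym (~-nodes p))

var≁fresh : occ v t ≡ 0 → ¬ var v ~ t
var≁fresh {v = v} v∉t p = 1+n≢0 (trans (sym (occ-var-self v)) (trans (~-occ p v) v∉t))

linear-·⇒≁ : Linear (a · b) → ¬ b ~ a
linear-·⇒≁ {a = a} (prod _ _ a∩b) p with vars-nonempty a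
... | k , k∈a = a∩b k k∈a (subst T (sym (~-vars p k)) k∈a)

≁-·ʳ : ¬ a ~ c → ¬ (a · b) ~ (c · b)
≁-·ʳ a≁c (str p _) = a≁c p
≁-·ʳ a≁c (crs p q) = a≁c (~-trans p q)

≁-·ˡ : ¬ b ~ d → ¬ (a · b) ~ (a · d)
≁-·ˡ b≁d (str _ q) = b≁d q
≁-·ˡ b≁d (crs p q) = b≁d (~-trans q p)

-- Assignments and dependence on variables

Assignment : ℕ → Set
Assignment n = Fin n → Bool

private
  variable
    P Q : Fin n → Bool
    x y w u r : Assignment n
    f g p q α β : Assignment n → Bool

∁ : (Fin n → Bool) → Fin n → Bool
∁ P i = not (P i)

∁-disjoint : T (∁ P i) → T (P i) → ⊥
∁-disjoint {P = P} {i = i} p q with P i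
∁-disjoint () _ | true

disjoint⇒⊆∁ : Disjoint a b → T (vars b i) → T (∁ (vars a) i)
disjoint⇒⊆∁ {a = a} {i = i} a∩b i∈b with vars a i in e
... | true  = a∩b i (subst T (sym e) _) i∈b
... | false = _

_≈[_]_ : Assignment n → (Fin n → Bool) → Assignment n → Set
x ≈[ P ] y = ∀ i → T (P i) → x i ≡ y i

≈-trans : x ≈[ P ] y → y ≈[ P ] w → x ≈[ P ] w
≈-trans x≈y y≈w i i∈P = trans (x≈y i i∈P) (y≈w i i∈P)

≈-⊆ : (∀ {i} → T (Q i) → T (P i)) → x ≈[ P ] y → x ≈[ Q ] y
≈-⊆ Q⊆P x≈y i = x≈y i ∘ Q⊆P

DependsOn : (Fin n → Bool) → (Assignment n → Bool) → Set
DependsOn P f = ∀ {x y} → x ≈[ P ] y → f x ≡ f y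

dependsOn-⊆ : (∀ {i} → T (P i) → T (Q i)) → DependsOn P f → DependsOn Q f
dependsOn-⊆ P⊆Q dep x≈y = dep (λ i → x≈y i ∘ P⊆Q)

merge : (Fin n → Bool) → Assignment n → Assignment n → Assignment n
merge P x y i = if P i then x i else y i

merge-≈ˡ : merge P x y ≈[ P ] x
merge-≈ˡ {P = P} i i∈P with P i
... | true = refl

merge-≈ʳ : (∀ {i} → T (Q i) → T (P i) → ⊥) → merge P x y ≈[ Q ] y
merge-≈ʳ {P = P} Q∩P i i∈Q with P i in e
... | true  = ⊥-elim (Q∩P i∈Q (subst T (sym e) _))
... | false = refl

merge-≈∁ : (P : Fin n → Bool) → merge P x y ≈[ ∁ P ] y
merge-≈∁ P = merge-≈ʳ {P = P} (∁-disjoint {P = P})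

merge-congʳ : x ≈[ Q ] y → merge P w x ≈[ Q ] merge P w y
merge-congʳ {P = P} x≈y i i∈Q with P i
... | true  = refl
... | false = x≈y i i∈Q

merge-≈-disjoint : Disjoint a b → merge (vars a) x y ≈[ vars b ] y
merge-≈-disjoint {a = a} a∩b = merge-≈ʳ {P = vars a} (λ i∈b i∈a → a∩b _ i∈a i∈b)

flipAt : Fin n → Assignment n → Assignment n
flipAt i x = updateAt x i not

flipAt-≈ : ¬ T (P i) → flipAt i x ≈[ P ] x
flipAt-≈ {P = P} {i = i} {x = x} i∉P j j∈P =
  updateAt-minimal j i x (λ { refl → i∉P j∈P })

flipAt-cong : x ≈[ P ] y → flipAt i x ≈[ P ] flipAt i y
flipAt-cong {x = x} {y = y} {i = i} x≈y j j∈P with j ≟ i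
... | yes refl =
  trans (updateAt-updates i x) (trans (cong not (x≈y i j∈P)) (sym (updateAt-updates i y)))
... | no j≢i =
  trans (updateAt-minimal j i x j≢i) (trans (x≈y j j∈P) (sym (updateAt-minimal j i y j≢i)))

Essential : Fin n → (Assignment n → Bool) → Set
Essential i f = ∃ λ x → f x ≢ f (flipAt i x)

essential-≗ : f ≗ g → Essential i f → Essential i g
essential-≗ f≗g (x , fx≢fx′) = x , λ e → fx≢fx′ (trans (f≗g x) (trans e (sym (f≗g _))))

-- At the point z, which agrees with u, w, y and r on P ∩ Q, P ∖ Q, Q ∖ P and the rest,
-- both conjuncts are true and both disjuncts are false.
∨≢∧ : DependsOn P p → DependsOn (∁ P) q → DependsOn Q α → DependsOn (∁ Q) β →
      p u ≡ true → q r ≡ true → α y ≡ false → β w ≡ false →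
      ¬ (∀ z → p z ∨ q z ≡ α z ∧ β z)
∨≢∧ {P = P} {p = p} {q = q} {Q = Q} {α = α} {β = β} {u = u} {r = r} {y = y} {w = w}
    dp dq dα dβ pu qr αy βw eq =
  false≢true (trans (sym (cong₂ _∨_ pz qz)) (trans (eq z) (cong₂ _∧_ αz βz)))
  where
  false≢true : false ≢ true
  false≢true ()

  z : Assignment _
  z = merge P (merge Q u w) (merge Q y r)

  α∧β-true : ∀ x → p x ∨ q x ≡ true → α x ≡ true × β x ≡ true
  α∧β-true x e = ∧-conicalˡ (α x) (β x) e′ , ∧-conicalʳ (α x) (β x) e′
    where e′ = trans (sym (eq x)) e

  p∨q-false : ∀ x → α x ∧ β x ≡ false → p x ≡ false × q x ≡ false
  p∨q-false x e = ∨-conicalˡ (p x) (q x) e′ , ∨-conicalʳ (p x) (q x) e′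
    where e′ = trans (eq x) e

  z≈[Q] : z ≈[ Q ] merge P u z
  z≈[Q] i i∈Q with P i | Q i
  ... | true  | true  = refl
  ... | false | _     = refl

  z≈[∁Q] : z ≈[ ∁ Q ] merge P z r
  z≈[∁Q] i i∉Q with P i | Q i
  ... | true  | _     = refl
  ... | false | false = refl

  z≈[P] : z ≈[ P ] merge Q z w
  z≈[P] i i∈P with P i | Q i
  ... | _     | true  = refl
  ... | true  | false = refl

  z≈[∁P] : z ≈[ ∁ P ] merge Q y z
  z≈[∁P] i i∉P with P i | Q i
  ... | false | true  = refl
  ... | _     | false = refl

  αz : α z ≡ true
  αz = trans (dα z≈[Q]) (proj₁ (α∧β-true (merge P u z)
         (cong (_∨ q (merge P u z)) (trans (dp merge-≈ˡ) pu))))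

  βz : β z ≡ true
  βz = trans (dβ z≈[∁Q]) (proj₂ (α∧β-true (merge P z r)
         (trans (cong (p (merge P z r) ∨_) (trans (dq (merge-≈∁ P)) qr)) (∨-zeroʳ _))))

  pz : p z ≡ false
  pz = trans (dp z≈[P]) (proj₁ (p∨q-false (merge Q z w)
         (trans (cong (α (merge Q z w) ∧_) (trans (dβ (merge-≈∁ Q)) βw)) (∧-zeroʳ _))))

  qz : q z ≡ false
  qz = trans (dq z≈[∁P]) (proj₂ (p∨q-false (merge Q y z)
         (cong (_∧ β (merge Q y z)) (trans (dα merge-≈ˡ) αy))))

∧-factor-falsifiable : DependsOn Q β → ¬ T (Q i) → Essential i (λ z → α z ∧ β z) →
                       ∃ λ y → α y ≡ false
∧-factor-falsifiable {β = β} {i = i} {α = α} dβ i∉Q (x , ≢)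
  with α x in αx | α (flipAt i x) in αx′
... | false | _     = x , αx
... | true  | false = flipAt i x , αx′
... | true  | true  = ⊥-elim (≢ (sym (dβ (flipAt-≈ i∉Q))))

-- Term operations of linear terms

⟦⟧-depends : (t : Term n) → DependsOn (vars t) ⟦ t ⟧
⟦⟧-depends (var i) x≈y = x≈y i (vars-var-self i)
⟦⟧-depends (a · b) x≈y =
  cong₂ _↓_ (⟦⟧-depends a (λ i → x≈y i ∘ vars-·ˡ))
            (⟦⟧-depends b (λ i → x≈y i ∘ vars-·ʳ))

⟦·⟧-restrict : ⟦ b ⟧ y ≡ false → w ≈[ vars a ] x → w ≈[ vars b ] y →
               ⟦ a · b ⟧ w ≡ not (⟦ a ⟧ x)
⟦·⟧-restrict {b = b} {a = a} {x = x} b≡false w≈x w≈y =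
  trans (cong₂ _↓_ (⟦⟧-depends a w≈x) (trans (⟦⟧-depends b w≈y) b≡false))
        (↓-falseʳ (⟦ a ⟧ x))

mutual
  linear-satisfiable : Linear t → ∃ λ x → ⟦ t ⟧ x ≡ true
  linear-satisfiable var = (λ _ → true) , refl
  linear-satisfiable (prod {a = a} {b = b} la lb a∩b)
    with linear-falsifiable la | linear-falsifiable lb
  ... | x , ax | y , by =
    merge (vars a) x y ,
    cong₂ _↓_ (trans (⟦⟧-depends a merge-≈ˡ) ax)
              (trans (⟦⟧-depends b (merge-≈-disjoint a∩b)) by)

  linear-falsifiable : Linear t → ∃ λ x → ⟦ t ⟧ x ≡ false
  linear-falsifiable var = (λ _ → false) , refl
  linear-falsifiable (prod {b = b} la _ _) with linear-satisfiable la
  ... | x , ax = x , cong (_↓ ⟦ b ⟧ x) ax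

essential-·ˡ : Linear b → Disjoint a b → T (vars a i) → Essential i ⟦ a ⟧ →
               Essential i ⟦ a · b ⟧
essential-·ˡ {b = b} {a = a} {i = i} lb a∩b i∈a (x , ax≢) with linear-falsifiable lb
... | y , by =
  z , λ e → ax≢ (not-injective (trans (sym (⟦·⟧-restrict by merge-≈ˡ z≈y))
                                      (trans e (⟦·⟧-restrict by (flipAt-cong merge-≈ˡ) flip-z≈y))))
  where
  z : Assignment _
  z = merge (vars a) x y
  z≈y : z ≈[ vars b ] y
  z≈y = merge-≈-disjoint a∩b
  flip-z≈y : flipAt i z ≈[ vars b ] y
  flip-z≈y = ≈-trans (flipAt-≈ (a∩b i i∈a)) z≈y

linear-essential : Linear t → T (vars t i) → Essential i ⟦ t ⟧
linear-essential {i = i} var i∈t with refl ← vars-var⁻ i∈t =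
  (λ _ → false) , λ e → false≢true (trans e (updateAt-updates i (λ _ → false)))
  where
  false≢true : false ≢ true
  false≢true ()
linear-essential (prod la lb a∩b) i∈ab with vars-·⁻ i∈ab
... | inj₁ i∈a = essential-·ˡ lb a∩b i∈a (linear-essential la i∈a)
... | inj₂ i∈b = essential-≗ (λ x → ↓-comm _ _)
                   (essential-·ˡ la (disjoint-sym a∩b) i∈b (linear-essential lb i∈b))

vars-swapʳ : vars (a · b) ≗ vars (c · d) → vars (a · b) ≗ vars (d · c)
vars-swapʳ {a = a} {b = b} {c = c} {d = d} vs i =
  trans (vs i) (trans (vars-· c d i) (trans (∨-comm (vars c i) (vars d i)) (sym (vars-· d c i))))

⟦·⟧-swapʳ : ∀ (a b c d : Term n) → ⟦ a · b ⟧ ≗ ⟦ c · d ⟧ → ⟦ a · b ⟧ ≗ ⟦ d · c ⟧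
⟦·⟧-swapʳ a b c d E x = trans (E x) (↓-comm (⟦ c ⟧ x) (⟦ d ⟧ x))

var≉· : Linear (c · d) → ¬ (vars (c · d) ≗ vars (var i))
var≉· {c = c} {d = d} (prod _ _ c∩d) vs with vars-nonempty c | vars-nonempty d
... | k , k∈c | l , l∈d
  with refl ← vars-var⁻ (subst T (vs k) (vars-·ˡ k∈c))
     | refl ← vars-var⁻ (subst T (vs l) (vars-·ʳ {a = c} l∈d)) = c∩d k k∈c l∈d

-- Fixing the variables of b where b is false turns the equation into ¬⟦a⟧ = ¬⟦c⟧ ∧ ¬⟦d⟧.
-- For a = a₁ · a₂ the left side is ⟦a₁⟧ ∨ ⟦a₂⟧, and the variables i and j, which are
-- essential for a, make both conjuncts falsifiable, so ∨≢∧ applies.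
factor-not-split : Linear (a · b) → Linear (c · d) → ⟦ a · b ⟧ ≗ ⟦ c · d ⟧ →
                   T (vars a i) → T (vars c i) → T (vars a j) → T (vars d j) → ⊥
factor-not-split (prod var _ _) (prod _ _ c∩d) _ i∈a i∈c j∈a j∈d
  with refl ← vars-var⁻ i∈a | refl ← vars-var⁻ j∈a = c∩d _ i∈c j∈d
factor-not-split {a = a₁ · a₂} {b = b} {c = c} {d = d} {i = i} {j = j}
                 (prod la@(prod l₁ l₂ a₁∩a₂) lb a∩b) (prod lc ld c∩d) E i∈a i∈c j∈a j∈d =
  ∨≢∧ {P = vars a₁} {Q = vars c}
      (⟦⟧-depends a₁) (dependsOn-⊆ (disjoint⇒⊆∁ a₁∩a₂) (⟦⟧-depends a₂)) dγ dδ
      (proj₂ (linear-satisfiable l₁)) (proj₂ (linear-satisfiable l₂))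
      (proj₂ (∧-factor-falsifiable dδ (λ i∉c → ∁-disjoint {P = vars c} i∉c i∈c) (essential i∈a)))
      (proj₂ (∧-factor-falsifiable dγ (λ j∈c → c∩d j j∈c j∈d)
               (essential-≗ (λ z → ∧-comm (γ z) (δ z)) (essential j∈a))))
      (λ z → trans (sym (not-↓ (⟦ a₁ ⟧ z) (⟦ a₂ ⟧ z))) (key z))
  where
  y₀ = proj₁ (linear-falsifiable lb)
  b≡false = proj₂ (linear-falsifiable lb)

  W : Assignment _ → Assignment _
  W z = merge (vars b) y₀ z

  γ δ : Assignment _ → Bool
  γ z = not (⟦ c ⟧ (W z))
  δ z = not (⟦ d ⟧ (W z))

  key : ∀ z → not (⟦ a₁ · a₂ ⟧ z) ≡ γ z ∧ δ z
  key z = trans (sym (⟦·⟧-restrict b≡false (merge-≈-disjoint (disjoint-sym a∩b)) merge-≈ˡ))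
                (trans (E (W z)) (↓≡not∧not (⟦ c ⟧ (W z)) (⟦ d ⟧ (W z))))

  dγ : DependsOn (vars c) γ
  dγ x≈y = cong not (⟦⟧-depends c (merge-congʳ {P = vars b} x≈y))

  dδ : DependsOn (∁ (vars c)) δ
  dδ = dependsOn-⊆ (disjoint⇒⊆∁ c∩d)
                   (λ x≈y → cong not (⟦⟧-depends d (merge-congʳ {P = vars b} x≈y)))

  essential : ∀ {k} → T (vars (a₁ · a₂) k) → Essential k (λ z → γ z ∧ δ z)
  essential k∈a = essential-≗ key (map₂ (λ ≢ → ≢ ∘ not-injective) (linear-essential la k∈a))

left-factor-≗ : Linear (a · b) → Linear (c · d) → vars a ≗ vars c → vars b ≗ vars d →
                ⟦ a · b ⟧ ≗ ⟦ c · d ⟧ → ⟦ a ⟧ ≗ ⟦ c ⟧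
left-factor-≗ {a = a} {b = b} {c = c} {d = d} lab@(prod _ _ a∩b) (prod _ _ c∩d) va vb E z =
  not-injective (trans (sym (⟦·⟧-restrict b≡false w₁≈z merge-≈ˡ))
                       (trans (E w₁) (⟦·⟧-restrict d≡false (≈-⊆ (subst T (sym (va _))) w₁≈z)
                                                          (≈-⊆ (subst T (sym (vb _))) merge-≈ˡ))))
  where
  x₁ = proj₁ (linear-satisfiable lab)
  ab≡true = proj₂ (linear-satisfiable lab)
  b≡false = proj₂ (↓≡true⁻ (⟦ a ⟧ x₁) (⟦ b ⟧ x₁) ab≡true)
  d≡false = proj₂ (↓≡true⁻ (⟦ c ⟧ x₁) (⟦ d ⟧ x₁) (trans (sym (E x₁)) ab≡true))

  w₁ : Assignment _
  w₁ = merge (vars b) x₁ z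

  w₁≈z : w₁ ≈[ vars a ] z
  w₁≈z = merge-≈-disjoint (disjoint-sym a∩b)

left-factor-⊆ : Linear (a · b) → Linear (c · d) → vars (a · b) ≗ vars (c · d) →
                ⟦ a · b ⟧ ≗ ⟦ c · d ⟧ → T (vars a i) → T (vars c i) → T (vars a j) → T (vars c j)
left-factor-⊆ lab lcd vs E i∈a i∈c j∈a with vars-·⁻ (subst T (vs _) (vars-·ˡ j∈a))
... | inj₁ j∈c = j∈c
... | inj₂ j∈d = ⊥-elim (factor-not-split lab lcd E i∈a i∈c j∈a j∈d)

right-factor-⊆ : Disjoint a b → vars (a · b) ≗ vars (c · d) →
                 (∀ {j} → T (vars c j) → T (vars a j)) → T (vars b j) → T (vars d j)
right-factor-⊆ {a = a} a∩b vs c⊆a j∈b with vars-·⁻ (subst T (vs _) (vars-·ʳ {a = a} j∈b))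
... | inj₁ j∈c = ⊥-elim (a∩b _ (c⊆a j∈c) j∈b)
... | inj₂ j∈d = j∈d

factors-≗ : Linear (a · b) → Linear (c · d) → vars (a · b) ≗ vars (c · d) →
            ⟦ a · b ⟧ ≗ ⟦ c · d ⟧ → T (vars a i) → T (vars c i) →
            (vars a ≗ vars c × ⟦ a ⟧ ≗ ⟦ c ⟧) × (vars b ≗ vars d × ⟦ b ⟧ ≗ ⟦ d ⟧)
factors-≗ {a = a} {b = b} {c = c} {d = d} lab@(prod _ _ a∩b) lcd@(prod _ _ c∩d) vs E i∈a i∈c =
  (va , left-factor-≗ lab lcd va vb E) ,
  (vb , left-factor-≗ (linear-swap lab) (linear-swap lcd) vb va
          (λ x → trans (↓-comm (⟦ b ⟧ x) (⟦ a ⟧ x)) (⟦·⟧-swapʳ a b c d E x)))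
  where
  a⊆c : ∀ {j} → T (vars a j) → T (vars c j)
  a⊆c = left-factor-⊆ lab lcd vs E i∈a i∈c

  c⊆a : ∀ {j} → T (vars c j) → T (vars a j)
  c⊆a = left-factor-⊆ lcd lab (sym ∘ vs) (sym ∘ E) i∈c i∈a

  va : vars a ≗ vars c
  va j = T-ext a⊆c c⊆a

  vb : vars b ≗ vars d
  vb j = T-ext (right-factor-⊆ a∩b vs c⊆a) (right-factor-⊆ c∩d (sym ∘ vs) a⊆c)

linear-≗⇒~ : Linear s → Linear t → vars s ≗ vars t → ⟦ s ⟧ ≗ ⟦ t ⟧ → s ~ t
linear-≗⇒~ {s = var i} {t = var j} _ _ vs _ = var~ (vars-var⁻ (subst T (vs i) (vars-var-self i)))
linear-≗⇒~ {s = var i} {t = c · d} _ lt vs _ = ⊥-elim (var≉· lt (sym ∘ vs))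
linear-≗⇒~ {s = a · b} {t = var j} ls _ vs _ = ⊥-elim (var≉· ls vs)
linear-≗⇒~ {s = a · b} {t = c · d} ls@(prod la lb _) lt@(prod lc ld _) vs E
  with i , i∈a ← vars-nonempty a | vars-·⁻ (subst T (vs i) (vars-·ˡ {b = b} i∈a))
... | inj₁ i∈c =
  let (va , Ea) , (vb , Eb) = factors-≗ ls lt vs E i∈a i∈c
  in str (linear-≗⇒~ la lc va Ea) (linear-≗⇒~ lb ld vb Eb)
... | inj₂ i∈d =
  let (va , Ea) , (vb , Eb) = factors-≗ ls (linear-swap lt) (vars-swapʳ vs) (⟦·⟧-swapʳ a b c d E) i∈a i∈d
  in crs (linear-≗⇒~ la ld va Ea) (linear-≗⇒~ lb lc vb Eb)

fullLinear-≗⇒~ : FullLinear s → FullLinear t → ⟦ s ⟧ ≗ ⟦ t ⟧ → s ~ t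
fullLinear-≗⇒~ fs ft = linear-≗⇒~ (fullLinear⇒linear fs) (fullLinear⇒linear ft)
  (λ i → trans (fullLinear⇒vars fs i) (sym (fullLinear⇒vars ft i)))

-- Renaming, removing and inserting a variable

rename : ∀ {m} → (Fin m → Fin n) → Term m → Term n
rename ρ (var i) = var (ρ i)
rename ρ (a · b) = rename ρ a · rename ρ b

occ-rename : ∀ {m} {ρ : Fin m → Fin n} → Injective _≡_ _≡_ ρ →
             ∀ i (t : Term m) → occ (ρ i) (rename ρ t) ≡ occ i t
occ-rename {ρ = ρ} ρ-inj i (var j) with i ≟ j
... | yes refl = occ-var-self (ρ i)
... | no i≢j   = occ-var-≢ (i≢j ∘ ρ-inj)
occ-rename ρ-inj i (a · b) = cong₂ _+_ (occ-rename ρ-inj i a) (occ-rename ρ-inj i b)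

occ-zero-rename-suc : (t : Term n) → occ zero (rename suc t) ≡ 0
occ-zero-rename-suc (var i) = refl
occ-zero-rename-suc (a · b) = cong₂ _+_ (occ-zero-rename-suc a) (occ-zero-rename-suc b)

nodes-rename : ∀ {m} (ρ : Fin m → Fin n) (t : Term m) → nodes (rename ρ t) ≡ nodes t
nodes-rename ρ (var i) = refl
nodes-rename ρ (a · b) = cong suc (cong₂ _+_ (nodes-rename ρ a) (nodes-rename ρ b))

rename-~ : ∀ {m} (ρ : Fin m → Fin n) {s t : Term m} → s ~ t → rename ρ s ~ rename ρ t
rename-~ ρ (var~ refl) = var~ refl
rename-~ ρ (str p q)   = str (rename-~ ρ p) (rename-~ ρ q)
rename-~ ρ (crs p q)   = crs (rename-~ ρ p) (rename-~ ρ q)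

rename-~⁻ : ∀ {m} {ρ : Fin m → Fin n} → Injective _≡_ _≡_ ρ →
            (s t : Term m) → rename ρ s ~ rename ρ t → s ~ t
rename-~⁻ ρ-inj (var i) (var j) (var~ e)  = var~ (ρ-inj e)
rename-~⁻ ρ-inj (a · b) (c · d) (str p q) = str (rename-~⁻ ρ-inj a c p) (rename-~⁻ ρ-inj b d q)
rename-~⁻ ρ-inj (a · b) (c · d) (crs p q) = crs (rename-~⁻ ρ-inj a d p) (rename-~⁻ ρ-inj b c q)

strengthen : (t : Term (suc n)) → occ zero t ≡ 0 → ∃ λ t′ → rename suc t′ ≡ t
strengthen (var zero)    ()
strengthen (var (suc i)) _ = var i , refl
strengthen (a · b) e
  with strengthen a (m+n≡0⇒m≡0 (occ zero a) e) | strengthen b (m+n≡0⇒n≡0 (occ zero a) e)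
... | a′ , refl | b′ , refl = a′ · b′ , refl

_·ᵐ_ : Maybe (Term n) → Maybe (Term n) → Maybe (Term n)
just a  ·ᵐ just b  = just (a · b)
just a  ·ᵐ nothing = just a
nothing ·ᵐ mb      = mb

remove : Fin n → Term n → Maybe (Term n)
remove v (var i) with v ≟ i
... | yes _ = nothing
... | no _  = just (var i)
remove v (a · b) = remove v a ·ᵐ remove v b

_~ᵐ_ : Maybe (Term n) → Maybe (Term n) → Set
_~ᵐ_ = Pointwise _~_

·ᵐ-cong : ∀ {ma mb mc md : Maybe (Term n)} → ma ~ᵐ mc → mb ~ᵐ md → (ma ·ᵐ mb) ~ᵐ (mc ·ᵐ md)
·ᵐ-cong (just p) (just q) = just (str p q)
·ᵐ-cong (just p) nothing  = just p
·ᵐ-cong nothing  q        = q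

·ᵐ-swap : ∀ (ma mb : Maybe (Term n)) → (ma ·ᵐ mb) ~ᵐ (mb ·ᵐ ma)
·ᵐ-swap (just a) (just b) = just (~-swap a b)
·ᵐ-swap (just a) nothing  = just (~-refl a)
·ᵐ-swap nothing  (just b) = just (~-refl b)
·ᵐ-swap nothing  nothing  = nothing

·ᵐ≡nothing⁻ : ∀ (ma mb : Maybe (Term n)) → ma ·ᵐ mb ≡ nothing → ma ≡ nothing × mb ≡ nothing
·ᵐ≡nothing⁻ nothing  nothing  _  = refl , refl
·ᵐ≡nothing⁻ (just _) (just _) ()
·ᵐ≡nothing⁻ (just _) nothing  ()
·ᵐ≡nothing⁻ nothing  (just _) ()

remove-~ : (v : Fin n) → s ~ t → remove v s ~ᵐ remove v t
remove-~ v (var~ refl) = Pointwise.refl (λ {t} → ~-refl t)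
remove-~ v (str p q)   = ·ᵐ-cong (remove-~ v p) (remove-~ v q)
remove-~ v (crs {c = c} p q) =
  Pointwise.trans ~-trans (·ᵐ-cong (remove-~ v p) (remove-~ v q)) (·ᵐ-swap _ (remove v c))

remove-fresh : (v : Fin n) (t : Term n) → occ v t ≡ 0 → remove v t ≡ just t
remove-fresh v (var i) e with v ≟ i
... | no _ = refl
remove-fresh v (a · b) e
  rewrite remove-fresh v a (m+n≡0⇒m≡0 (occ v a) e) | remove-fresh v b (m+n≡0⇒n≡0 (occ v a) e) = refl

remove-·-var : (v : Fin n) (t : Term n) → occ v t ≡ 0 → remove v (t · var v) ≡ just t
remove-·-var v t v∉t with v ≟ v
... | yes _  rewrite remove-fresh v t v∉t = refl
... | no v≢v = ⊥-elim (v≢v refl)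

remove≡nothing : (v : Fin n) (t : Term n) → occ v t ≡ 1 → remove v t ≡ nothing → t ≡ var v
remove≡nothing v (var i) _ e with v ≟ i
remove≡nothing v (var i) _ _  | yes refl = refl
remove≡nothing v (var i) _ () | no _
remove≡nothing v (a · b) o e
  with m+n≡1 (occ v a) (occ v b) o | ·ᵐ≡nothing⁻ (remove v a) (remove v b) e
... | inj₁ (_ , v∉b) | _ , rb = ⊥-elim (just≢nothing (trans (sym (remove-fresh v b v∉b)) rb))
  where just≢nothing : just b ≢ nothing
        just≢nothing ()
... | inj₂ (v∉a , _) | ra , _ = ⊥-elim (just≢nothing (trans (sym (remove-fresh v a v∉a)) ra))
  where just≢nothing : just a ≢ nothing
        just≢nothing ()

occᵐ : Fin n → Maybe (Term n) → ℕ
occᵐ i = maybe′ (occ i) 0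

occᵐ-·ᵐ : (i : Fin n) (ma mb : Maybe (Term n)) → occᵐ i (ma ·ᵐ mb) ≡ occᵐ i ma + occᵐ i mb
occᵐ-·ᵐ i (just a) (just b) = refl
occᵐ-·ᵐ i (just a) nothing  = sym (+-identityʳ (occ i a))
occᵐ-·ᵐ i nothing  mb       = refl

occᵐ-remove-self : (v : Fin n) (t : Term n) → occᵐ v (remove v t) ≡ 0
occᵐ-remove-self v (var i) with v ≟ i
... | yes _  = refl
... | no v≢i = occ-var-≢ v≢i
occᵐ-remove-self v (a · b) = trans (occᵐ-·ᵐ v (remove v a) (remove v b))
                                   (cong₂ _+_ (occᵐ-remove-self v a) (occᵐ-remove-self v b))

occᵐ-remove : i ≢ v → (t : Term n) → occᵐ i (remove v t) ≡ occ i t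
occᵐ-remove {v = v} i≢v (var i) with v ≟ i
... | yes refl = sym (occ-var-≢ i≢v)
... | no _     = refl
occᵐ-remove {i = i} {v = v} i≢v (a · b) = trans (occᵐ-·ᵐ i (remove v a) (remove v b))
                                                (cong₂ _+_ (occᵐ-remove i≢v a) (occᵐ-remove i≢v b))

insert : Fin n → Term n → List (Term n)
insert v (var i) = (var i · var v) ∷ []
insert v (a · b) = ((a · b) · var v) ∷ map (_· b) (insert v a) ++ map (a ·_) (insert v b)

insert-head : t ~ (a · var v) → Any (t ~_) (insert v a)
insert-head {a = var i} p = here p
insert-head {a = c · d} p = here p

insert-occ : (v : Fin n) (t : Term n) → All (λ u → ∀ i → occ i u ≡ occ i (t · var v)) (insert v t)
insert-occ v (var j) = (λ i → refl) ∷ []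
insert-occ v (a · b) = (λ i → refl) ∷ All.++⁺
  (All.map⁺ (All.map (λ e i → trans (cong (_+ occ i b) (e i))
                                    (xy∙z≈xz∙y (occ i a) (occ i (var v)) (occ i b)))
                     (insert-occ v a)))
  (All.map⁺ (All.map (λ e i → trans (cong (occ i a +_) (e i))
                                    (sym (+-assoc (occ i a) (occ i b) (occ i (var v)))))
                     (insert-occ v b)))

insert-nodes : (v : Fin n) (t : Term n) → All (λ u → nodes u ≡ suc (nodes t)) (insert v t)
insert-nodes v (var i) = refl ∷ []
insert-nodes v (a · b) = cong suc (+-identityʳ _) ∷ All.++⁺
  (All.map⁺ (All.map (λ e → cong (λ k → suc (k + nodes b)) e) (insert-nodes v a)))
  (All.map⁺ (All.map (λ e → cong suc (trans (cong (nodes a +_) e) (+-suc (nodes a) (nodes b))))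
                     (insert-nodes v b)))

length-insert : (v : Fin n) (t : Term n) → length (insert v t) ≡ suc (2 * nodes t)
length-insert v (var i) = refl
length-insert v (a · b) = cong suc (begin
  length (map (_· b) (insert v a) ++ map (a ·_) (insert v b))
    ≡⟨ length-++ (map (_· b) (insert v a)) ⟩
  length (map (_· b) (insert v a)) + length (map (a ·_) (insert v b))
    ≡⟨ cong₂ _+_ (length-map (_· b) (insert v a)) (length-map (a ·_) (insert v b)) ⟩
  length (insert v a) + length (insert v b)
    ≡⟨ cong₂ _+_ (length-insert v a) (length-insert v b) ⟩
  suc (2 * nodes a) + suc (2 * nodes b)
    ≡⟨ arithmetic (nodes a) (nodes b) ⟩
  2 * suc (nodes a + nodes b) ∎)
  where
  open ≡-Reasoning
  arithmetic : ∀ x y → suc (2 * x) + suc (2 * y) ≡ 2 * suc (x + y)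
  arithmetic = solve-∀

insert-remove : (v : Fin n) (t : Term n) → occ v t ≡ 0 → All (λ u → remove v u ≡ just t) (insert v t)
insert-remove v (var i) v∉t = remove-·-var v (var i) v∉t ∷ []
insert-remove v (a · b) v∉t = remove-·-var v (a · b) v∉t ∷ All.++⁺
  (All.map⁺ (All.map (λ e → cong₂ _·ᵐ_ e (remove-fresh v b v∉b)) (insert-remove v a v∉a)))
  (All.map⁺ (All.map (λ e → cong₂ _·ᵐ_ (remove-fresh v a v∉a) e) (insert-remove v b v∉b)))
  where
  v∉a = m+n≡0⇒m≡0 (occ v a) v∉t
  v∉b = m+n≡0⇒n≡0 (occ v a) v∉t

insert-distinct : (v : Fin n) (t : Term n) → Linear t → occ v t ≡ 0 →
                  AllPairs (λ u u′ → ¬ u ~ u′) (insert v t)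
insert-distinct v (var i) _ _ = [] ∷ []
insert-distinct v (a · b) lab@(prod la lb _) v∉t =
  All.++⁺ (All.map⁺ (All.universal head≁·ʳ (insert v a)))
          (All.map⁺ (All.universal head≁·ˡ (insert v b))) ∷
  AllPairs.++⁺ (AllPairs.map⁺ (AllPairs.map ≁-·ʳ (insert-distinct v a la v∉a)))
               (AllPairs.map⁺ (AllPairs.map ≁-·ˡ (insert-distinct v b lb v∉b)))
               (All.map⁺ (All.map (λ occ-x → All.map⁺ (All.universal (cross occ-x) (insert v b)))
                                  (insert-occ v a)))
  where
  v∉a = m+n≡0⇒m≡0 (occ v a) v∉t
  v∉b = m+n≡0⇒n≡0 (occ v a) v∉t

  head≁·ʳ : ∀ x → ¬ ((a · b) · var v) ~ (x · b)
  head≁·ʳ x (str _ q) = var≁fresh v∉b q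
  head≁·ʳ x (crs p _) = ·≁ʳ p

  head≁·ˡ : ∀ y → ¬ ((a · b) · var v) ~ (a · y)
  head≁·ˡ y (str p _) = ·≁ˡ p
  head≁·ˡ y (crs _ q) = var≁fresh v∉a q

  cross : ∀ {x} → (∀ i → occ i x ≡ occ i (a · var v)) → ∀ y → ¬ (x · b) ~ (a · y)
  cross occ-x y (str p _) =
    1+n≢0 (trans (sym (trans (occ-x v) (cong₂ _+_ v∉a (occ-var-self v)))) (trans (~-occ p v) v∉a))
  cross occ-x y (crs _ q) = linear-·⇒≁ lab q

insert-complete-·ˡ : occ v a ≡ 1 → (∀ {c} → remove v a ~ᵐ just c → Any (a ~_) (insert v c)) →
                     (remove v a ·ᵐ just b) ~ᵐ just c → Any ((a · b) ~_) (insert v c)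
insert-complete-·ˡ {v = v} {a = a} v∈a IH r with remove v a in ra
... | nothing with refl ← remove≡nothing v a v∈a ra =
  insert-head (crs (~-refl (var v)) (Pointwise.drop-just r))
... | just a′ with r
...   | just (str {c = c} {d = d} a′~c b~d) =
  there (Any.++⁺ˡ (Any.map⁺ (Any.map (λ q → str q b~d) (IH (just a′~c)))))
...   | just (crs {d = d} {c = c} a′~d b~c) =
  there (Any.++⁺ʳ (map (_· d) (insert v c)) (Any.map⁺ (Any.map (λ q → crs q b~c) (IH (just a′~d)))))

insert-complete : (v : Fin n) (t : Term n) → occ v t ≡ 1 → remove v t ~ᵐ just c →
                  Any (t ~_) (insert v c)
insert-complete v (var i) v∈t r with v ≟ i
insert-complete v (var i) v∈t () | yes _
insert-complete v (var i) ()  r  | no _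
insert-complete v (a · b) v∈t r with m+n≡1 (occ v a) (occ v b) v∈t
... | inj₁ (v∈a , v∉b) =
  insert-complete-·ˡ v∈a (insert-complete v a v∈a)
    (subst (λ mb → (remove v a ·ᵐ mb) ~ᵐ just _) (remove-fresh v b v∉b) r)
... | inj₂ (v∉a , v∈b) =
  Any.map (~-trans (~-swap a b))
    (insert-complete-·ˡ v∈b (insert-complete v b v∈b)
      (subst (λ ma → (remove v b ·ᵐ ma) ~ᵐ just _) (remove-fresh v a v∉a)
        (Pointwise.trans ~-trans (·ᵐ-swap (remove v b) (remove v a)) r)))

-- Full linear terms up to commutativity

linear-rename-suc : FullLinear t → Linear (rename suc t)
linear-rename-suc {t = t} fl = occ≤1⇒linear (rename suc t) occ≤1
  where
  occ≤1 : ∀ i → occ i (rename suc t) ≤ 1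
  occ≤1 zero    = subst (_≤ 1) (sym (occ-zero-rename-suc t)) z≤n
  occ≤1 (suc j) = ≤-reflexive (trans (occ-rename suc-injective j t) (fl j))

fullLinear-insert : FullLinear t → All FullLinear (insert zero (rename suc t))
fullLinear-insert {t = t} fl =
  All.map (λ e i → trans (e i) (occ-block i)) (insert-occ zero (rename suc t))
  where
  occ-block : ∀ i → occ i (rename suc t · var zero) ≡ 1
  occ-block zero    = cong (_+ 1) (occ-zero-rename-suc t)
  occ-block (suc j) = cong (_+ 0) (trans (occ-rename suc-injective j t) (fl j))

remove-zero-fullLinear : ∀ {m} {t : Term (suc (suc m))} → FullLinear t →
                         ∃ λ t′ → remove zero t ≡ just (rename suc t′) × FullLinear t′
remove-zero-fullLinear {t = t} fl with remove zero t in rt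
... | nothing = ⊥-elim (1+n≢0 (begin
  1                                  ≡⟨ fl (suc zero) ⟨
  occ (suc zero) t                   ≡⟨ occᵐ-remove (λ ()) t ⟨
  occᵐ (suc zero) (remove zero t)    ≡⟨ cong (occᵐ (suc zero)) rt ⟩
  0                                  ∎))
  where open ≡-Reasoning
... | just t₀ with strengthen t₀ (trans (cong (occᵐ zero) (sym rt)) (occᵐ-remove-self zero t))
...   | t′ , refl = t′ , refl , fl′
  where
  fl′ : FullLinear t′
  fl′ j = trans (sym (occ-rename suc-injective j t′))
                (trans (cong (occᵐ (suc j)) (sym rt)) (trans (occᵐ-remove (λ ()) t) (fl (suc j))))

representatives : (m : ℕ) → List (Term (suc m))
representatives zero    = var zero ∷ []
representatives (suc m) = concatMap (insert zero ∘ rename suc) (representatives m)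

representatives-fullLinear : ∀ m → All FullLinear (representatives m)
representatives-fullLinear zero    = (λ { zero → refl }) ∷ []
representatives-fullLinear (suc m) =
  All.concat⁺ (All.map⁺ (All.map fullLinear-insert (representatives-fullLinear m)))

representatives-nodes : ∀ m → All (λ t → nodes t ≡ m) (representatives m)
representatives-nodes zero    = refl ∷ []
representatives-nodes (suc m) = All.concat⁺ (All.map⁺ (All.map (λ {t} e →
  All.map (λ e′ → trans e′ (cong suc (trans (nodes-rename suc t) e))) (insert-nodes zero (rename suc t)))
  (representatives-nodes m)))

representatives-distinct : ∀ m → AllPairs (λ s t → ¬ s ~ t) (representatives m)
representatives-distinct zero    = [] ∷ []
representatives-distinct (suc m) = AllPairs.concat⁺
  (All.map⁺ (All.map (λ {t} fl → insert-distinct zero (rename suc t) (linear-rename-suc fl)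
                                                  (occ-zero-rename-suc t))
                     (representatives-fullLinear m)))
  (AllPairs.map⁺ (AllPairs.map blocks-apart (representatives-distinct m)))
  where
  blocks-apart : ∀ {t t′} → ¬ t ~ t′ →
                 All (λ u → All (λ u′ → ¬ u ~ u′) (insert zero (rename suc t′))) (insert zero (rename suc t))
  blocks-apart {t} {t′} t≁t′ =
    All.map (λ ru → All.map (λ ru′ u~u′ → t≁t′ (rename-~⁻ suc-injective t t′
                              (Pointwise.drop-just (subst₂ _~ᵐ_ ru ru′ (remove-~ zero u~u′)))))
                            (insert-remove zero (rename suc t′) (occ-zero-rename-suc t′)))
            (insert-remove zero (rename suc t) (occ-zero-rename-suc t))

representatives-complete : ∀ m (t : Term (suc m)) → FullLinear t → Any (t ~_) (representatives m)
representatives-complete zero (var zero) _ = here (~-refl (var zero))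
representatives-complete zero (a · b) fl
  with fullLinear⇒linear {t = a · b} fl | vars-nonempty a | vars-nonempty b
... | prod _ _ a∩b | zero , 0∈a | zero , 0∈b = ⊥-elim (a∩b zero 0∈a 0∈b)
representatives-complete (suc m) t fl with t′ , rt , fl′ ← remove-zero-fullLinear {t = t} fl =
  Any.concat⁺ (Any.map⁺ (Any.map (λ {s} t′~s →
    insert-complete zero t (fl zero) (subst (_~ᵐ just (rename suc s)) (sym rt) (just (rename-~ suc t′~s))))
    (representatives-complete m t′ fl′)))

-- Counting

length-concatMap-const : ∀ {A B : Set} {f : A → List B} {k} {xs : List A} →
                         All (λ x → length (f x) ≡ k) xs → length (concatMap f xs) ≡ length xs * k
length-concatMap-const {f = f} {xs = []}     []       = refl
length-concatMap-const {f = f} {xs = x ∷ xs} (e ∷ es) =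
  trans (length-++ (f x)) (cong₂ _+_ e (length-concatMap-const es))

length-representatives : ∀ m → length (representatives m) * (2 ^ m * m !) ≡ (2 * m) !
length-representatives zero    = refl
length-representatives (suc m) = begin
  length (representatives (suc m)) * (2 ^ suc m * suc m !)
    ≡⟨ cong (_* (2 ^ suc m * suc m !)) (length-concatMap-const (All.map block-length (representatives-nodes m))) ⟩
  l * suc (2 * m) * (2 * 2 ^ m * (suc m * m !))
    ≡⟨ arithmetic l (2 ^ m) (m !) m ⟩
  (2 + 2 * m) * (suc (2 * m) * (l * (2 ^ m * m !)))
    ≡⟨ cong (λ k → (2 + 2 * m) * (suc (2 * m) * k)) (length-representatives m) ⟩
  (2 + 2 * m) * (suc (2 * m) * (2 * m) !)
    ≡⟨ cong _! (*-suc 2 m) ⟨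
  (2 * suc m) ! ∎
  where
  open ≡-Reasoning
  l = length (representatives m)

  block-length : ∀ {t} → nodes t ≡ m → length (insert zero (rename suc t)) ≡ suc (2 * m)
  block-length {t} e = trans (length-insert zero (rename suc t)) (cong (λ k → suc (2 * k)) (trans (nodes-rename suc t) e))

  arithmetic : ∀ l p f m → l * suc (2 * m) * (2 * p * (suc m * f)) ≡
                           (2 + 2 * m) * (suc (2 * m) * (l * (p * f)))
  arithmetic = solve-∀

length-representatives≡D : ∀ m → length (representatives m) ≡ D m
length-representatives≡D m = begin
  length (representatives m)                                ≡⟨ m*n/n≡m l (2 ^ m * m !) ⟨
  length (representatives m) * (2 ^ m * m !) / (2 ^ m * m !) ≡⟨ cong (_/ (2 ^ m * m !)) (length-representatives m) ⟩
  (2 * m) ! / (2 ^ m * m !)                                 ∎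
  where
  open ≡-Reasoning
  l = length (representatives m)
  instance
    _ : NonZero (2 ^ m * m !)
    _ = m*n≢0 (2 ^ m) (m !) {{m^n≢0 2 m}} {{m !≢0}}

allPairs-map-All : ∀ {A : Set} {P : A → Set} {R S : A → A → Set} {xs : List A} →
                   (∀ {x y} → P x → P y → R x y → S x y) → All P xs → AllPairs R xs → AllPairs S xs
allPairs-map-All f []         []         = []
allPairs-map-All f (px ∷ pxs) (rx ∷ rxs) =
  All.zipWith (λ (py , r) → f px py r) (pxs , rx) ∷ allPairs-map-All f pxs rxs

proposition6p9 : (m : ℕ) →
    Σ (List (Term (suc m))) λ ts →
      All FullLinear ts
      × AllPairs (λ s t → ¬ ((a : Fin (suc m) → Bool) → ⟦ s ⟧ a ≡ ⟦ t ⟧ a)) ts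
      × ((t : Term (suc m)) → FullLinear t →
           Any (λ s → (a : Fin (suc m) → Bool) → ⟦ t ⟧ a ≡ ⟦ s ⟧ a) ts)
      × length ts ≡ D m
proposition6p9 m =
  representatives m ,
  representatives-fullLinear m ,
  allPairs-map-All (λ fs ft s≁t E → s≁t (fullLinear-≗⇒~ fs ft E))
                   (representatives-fullLinear m) (representatives-distinct m) ,
  (λ t fl → Any.map ~-sound (representatives-complete m t fl)) ,
  length-representatives≡D m
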